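{- Let $w$ be a non-empty finite word. If $|w|=R_w+K_w+|\mathrm{Alph}(w)|-2$, then $w$ is a GT-word.
   Context: Words are finite sequences of letters; $|w|$ is the length and $\mathrm{Alph}(w)$ the set of letters of $w$. A factor is a contiguous subword. $C_w(n)$ is the number of distinct factors of $w$ of length $n$. A factor $u$ of $w$ is right special if $ux$ is a factor of $w$ for at least two distinct letters $x$. $R_w$ is the smallest positive integer $r$ such that $w$ has no right special factor of length $r$ (so $R_w=1$ if $w$ has only one distinct letter); $K_w$ is the length of the shortest suffix of $w$ occurring exactly once in $w$. A word $w$ with $|\mathrm{Alph}(w)|\ge 2$ is a GT-word if there exist positive integers $m\le M$ such that $C_w(0)=1$, $C_w(i)=|\mathrm{Alph}(w)|+i-1$ for $1\le i\le m$, $C_w(i+1)=C_w(i)$ for $m\le i\le M-1$, and $C_w(i+1)=C_w(i)-1$ for $M\le i\le |w|$ (with $C_w(|w|+1)=0$). Every non-empty word with one distinct letter is also a GT-word. -}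

module Defs where

open import Data.Nat using (ℕ; zero; suc; _+_; _∸_; _≤_; _<_)
open import Data.Nat.Properties using () renaming (_≟_ to _≟ℕ_)
open import Data.List using (List; []; _∷_; _++_; [_]; length; take; tails; filter; deduplicate)
open import Data.List.Properties using (≡-dec)
open import Data.Product using (Σ; ∃; _×_; _,_)
open import Data.Sum using (_⊎_)
open import Relation.Nullary using (¬_)
open import Relation.Binary.PropositionalEquality using (_≡_; _≢_)
open import Relation.Binary.Definitions using (DecidableEquality)

module Words {A : Set} (_≟_ : DecidableEquality A) where

  Word : Set
  Word = List A

  _≟w_ : DecidableEquality Word
  _≟w_ = ≡-dec _≟_

  alphSize : Word → ℕ
  alphSize w = length (deduplicate _≟_ w)

  Factor : Word → Word → Set
  Factor u w = ∃ λ p → ∃ λ s → p ++ u ++ s ≡ w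

  Suffix : Word → Word → Set
  Suffix s w = ∃ λ p → p ++ s ≡ w

  -- all occurrences (with multiplicity, one per starting position) of factors of length n
  windows : ℕ → Word → List Word
  windows n w = filter (λ u → length u ≟ℕ n) (Data.List.map (take n) (tails w))

  C : Word → ℕ → ℕ
  C w n = length (deduplicate _≟w_ (windows n w))

  occ : Word → Word → ℕ
  occ u w = length (filter (λ v → v ≟w u) (windows (length u) w))

  RightSpecial : Word → Word → Set
  RightSpecial u w = ∃ λ x → ∃ λ y → x ≢ y × Factor (u ++ [ x ]) w × Factor (u ++ [ y ]) w

  IsR : Word → ℕ → Set
  IsR w r = 1 ≤ r
          × (∀ u → length u ≡ r → ¬ RightSpecial u w)
          × (∀ r' → 1 ≤ r' → r' < r → ∃ λ u → length u ≡ r' × RightSpecial u w)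

  IsK : Word → ℕ → Set
  IsK w k = (∃ λ s → Suffix s w × occ s w ≡ 1 × length s ≡ k)
          × (∀ s → Suffix s w → occ s w ≡ 1 → k ≤ length s)

  GT : Word → Set
  GT w = (w ≢ [] × alphSize w ≡ 1)
       ⊎ (2 ≤ alphSize w × (∃ λ m → ∃ λ M → 1 ≤ m × m ≤ M
            × C w 0 ≡ 1
            × (∀ i → 1 ≤ i → i ≤ m → C w i ≡ alphSize w + i ∸ 1)
            × (∀ i → m ≤ i → i ≤ M ∸ 1 → C w (suc i) ≡ C w i)
            × (∀ i → M ≤ i → i ≤ length w → C w (suc i) + 1 ≡ C w i)))

-- Write C(n) for the number of distinct factors of length n.  Every factor of
-- length n is either a prefix of a factor of length n+1, or the suffix of w of
-- length n; the latter is needed only when that suffix is unextendable, which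
-- forces n ≥ K_w.  A right special factor of length n makes two length-(n+1)
-- factors share their length-n prefix.  Hence, for 1 ≤ n ≤ |w|,
--     C(n) + [n < R_w]  ≤  C(n+1) + [K_w ≤ n],   and   C(0) + |Alph| - 1 ≤ C(1).
-- Summing these inequalities over 0 ≤ n ≤ |w| (the C terms telescope, since
-- C(0) = 1 and C(|w|+1) = 0) and using the length hypothesis shows that the sum
-- of the right-hand sides does not exceed the sum of the left-hand sides, so
-- every inequality is an equality.  The resulting exact recurrence makes C rise
-- by one below min(R_w, K_w), stay flat up to max(R_w, K_w) and fall by one
-- afterwards, which is the GT profile.
module Submission where

open import Defs
open import Function using (_∘_)
open import Data.Nat using (ℕ; zero; suc; _+_; _∸_; _≤_; _<_; z≤n; s≤s; s≤s⁻¹; _≤?_; _<?_)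
open import Data.Nat.Properties hiding (_≟_)
open import Data.Nat.Properties using () renaming (_≟_ to _≟ℕ_)
open import Data.List using (List; []; _∷_; _++_; [_]; length; map; filter; deduplicate; take; drop; tails)
open import Data.List.Properties
  using (length-++; length-map; length-drop; length-++-≤ˡ; length-++-≤ʳ; ++-assoc; ++-identityʳ;
         take++drop≡id; take-all; ∷-injectiveˡ; filter-notAll; filter-accept; filter-reject; filter-none)
open import Data.List.Relation.Unary.All as All using (All; [])
open import Data.List.Relation.Unary.Any as Any using (here; there)
open import Data.List.Relation.Unary.AllPairs using ([]; _∷_)
open import Data.List.Relation.Unary.Unique.Propositional using (Unique)
import Data.List.Relation.Unary.Unique.Propositional.Properties as Unique
open import Data.List.Relation.Unary.Unique.DecPropositional.Properties using (deduplicate-!)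
open import Data.List.Relation.Binary.Subset.Propositional using (_⊆_)
open import Data.List.Membership.Propositional using (_∈_)
open import Data.List.Membership.Propositional.Properties
open import Data.Product using (∃₂; _×_; _,_; proj₁; proj₂)
open import Data.Sum using (_⊎_; inj₁; inj₂)
open import Data.Empty using (⊥-elim)
open import Relation.Nullary using (¬_; Dec; yes; no; ¬?)
open import Relation.Unary using (Decidable)
open import Relation.Binary.PropositionalEquality hiding ([_])
open import Relation.Binary.Definitions using (DecidableEquality)
open import Data.Nat.Tactic.RingSolver using (solve-∀)

module Counting {B : Set} (_≟_ : DecidableEquality B) where

  card : List B → ℕ
  card xs = length (deduplicate _≟_ xs)

  unique-length≤ : ∀ {xs ys} → Unique xs → xs ⊆ ys → length xs ≤ length ys
  unique-length≤ {[]} _ _ = z≤n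
  unique-length≤ {x ∷ xs} {ys} (x∉xs ∷ xs!) xs⊆ys =
    ≤-trans (s≤s (unique-length≤ xs! xs⊆ys-x)) ys-x<ys
    where
    ys-x : List B
    ys-x = filter (¬? ∘ (x ≟_)) ys
    xs⊆ys-x : xs ⊆ ys-x
    xs⊆ys-x z∈xs = ∈-filter⁺ (¬? ∘ (x ≟_)) (xs⊆ys (there z∈xs)) (All.lookup x∉xs z∈xs)
    ys-x<ys : length ys-x < length ys
    ys-x<ys = filter-notAll (¬? ∘ (x ≟_)) ys (Any.map (λ x≡y x≢y → x≢y x≡y) (xs⊆ys (here refl)))

  card-≥ : ∀ {zs xs} → Unique zs → zs ⊆ xs → length zs ≤ card xs
  card-≥ zs! zs⊆xs = unique-length≤ zs! (∈-deduplicate⁺ _≟_ ∘ zs⊆xs)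

  card-cover : ∀ (ts ys : List B) (f : B → B) {xs} →
               xs ⊆ ts ++ map f ys → card xs ≤ length ts + card ys
  card-cover ts ys f {xs} xs⊆ =
    subst (card xs ≤_) length-cover (unique-length≤ (deduplicate-! _≟_ xs) dedup⊆)
    where
    length-cover : length (ts ++ map f (deduplicate _≟_ ys)) ≡ length ts + card ys
    length-cover = trans (length-++ ts) (cong (length ts +_) (length-map f (deduplicate _≟_ ys)))
    dedup⊆ : deduplicate _≟_ xs ⊆ ts ++ map f (deduplicate _≟_ ys)
    dedup⊆ z∈ with ∈-++⁻ ts (xs⊆ (∈-deduplicate⁻ _≟_ xs z∈))
    ... | inj₁ z∈ts = ∈-++⁺ˡ z∈ts
    ... | inj₂ z∈fys with ∈-map⁻ f z∈fys
    ...   | y , y∈ys , refl = ∈-++⁺ʳ ts (∈-map⁺ f (∈-deduplicate⁺ _≟_ y∈ys))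

  card-cover-strict : ∀ (ts ys : List B) (f : B → B) {xs} (a b : B) →
                      a ∈ ys → b ∈ ys → a ≢ b → f a ≡ f b →
                      xs ⊆ ts ++ map f ys → suc (card xs) ≤ length ts + card ys
  card-cover-strict ts ys f {xs} a b a∈ys b∈ys a≢b fa≡fb xs⊆ = begin
    suc (card xs)               ≤⟨ s≤s (card-cover ts ys-b f xs⊆′) ⟩
    suc (length ts + card ys-b) ≡⟨ sym (+-suc (length ts) (card ys-b)) ⟩
    length ts + suc (card ys-b) ≤⟨ +-monoʳ-≤ (length ts) ys-b<ys ⟩
    length ts + card ys         ∎
    where
    open ≤-Reasoning
    ys-b : List B
    ys-b = filter (¬? ∘ (b ≟_)) ys
    -- b is redundant: its image is also the image of a, which stays in ys-b
    xs⊆′ : xs ⊆ ts ++ map f ys-b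
    xs⊆′ z∈xs with ∈-++⁻ ts (xs⊆ z∈xs)
    ... | inj₁ z∈ts = ∈-++⁺ˡ z∈ts
    ... | inj₂ z∈fys with ∈-map⁻ f z∈fys
    ...   | y , y∈ys , refl with b ≟ y
    ...     | yes refl = ∈-++⁺ʳ ts (subst (_∈ map f ys-b) fa≡fb
                           (∈-map⁺ f (∈-filter⁺ (¬? ∘ (b ≟_)) a∈ys (a≢b ∘ sym))))
    ...     | no b≢y = ∈-++⁺ʳ ts (∈-map⁺ f (∈-filter⁺ (¬? ∘ (b ≟_)) y∈ys b≢y))
    dedup[ys-b]⊆ys : deduplicate _≟_ ys-b ⊆ ys
    dedup[ys-b]⊆ys = proj₁ ∘ ∈-filter⁻ (¬? ∘ (b ≟_)) {xs = ys} ∘ ∈-deduplicate⁻ _≟_ ys-b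
    b∉ys-b : All (b ≢_) (deduplicate _≟_ ys-b)
    b∉ys-b = All.tabulate (proj₂ ∘ ∈-filter⁻ (¬? ∘ (b ≟_)) {xs = ys} ∘ ∈-deduplicate⁻ _≟_ ys-b)
    ys-b<ys : suc (card ys-b) ≤ card ys
    ys-b<ys = card-≥ (b∉ys-b ∷ deduplicate-! _≟_ ys-b)
                     λ { (here refl) → b∈ys ; (there z∈) → dedup[ys-b]⊆ys z∈ }

module Sums where

  indicator : ∀ {P : Set} → Dec P → ℕ
  indicator (yes _) = 1
  indicator (no _) = 0

  indicator-yes : ∀ {P : Set} (d : Dec P) → P → indicator d ≡ 1
  indicator-yes (yes _) _ = refl
  indicator-yes (no ¬p) p = ⊥-elim (¬p p)

  indicator-no : ∀ {P : Set} (d : Dec P) → ¬ P → indicator d ≡ 0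
  indicator-no (yes p) ¬p = ⊥-elim (¬p p)
  indicator-no (no _) _ = refl

  when : ∀ {P : Set} {B : Set} → Dec P → List B → List B
  when (yes _) xs = xs
  when (no _) _ = []

  length-when : ∀ {P : Set} {B : Set} (d : Dec P) (x : B) → length (when d [ x ]) ≡ indicator d
  length-when (yes _) _ = refl
  length-when (no _) _ = refl

  Σ< : (ℕ → ℕ) → ℕ → ℕ
  Σ< f zero = 0
  Σ< f (suc N) = Σ< f N + f N

  Σ-+ : ∀ f g N → Σ< (λ n → f n + g n) N ≡ Σ< f N + Σ< g N
  Σ-+ f g zero = refl
  Σ-+ f g (suc N) = trans (cong (_+ (f N + g N)) (Σ-+ f g N)) (shuffle (Σ< f N) (Σ< g N) (f N) (g N))
    where
    shuffle : ∀ a b c d → (a + b) + (c + d) ≡ (a + c) + (b + d)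
    shuffle = solve-∀

  Σ-telescope : ∀ f N → Σ< (f ∘ suc) N + f 0 ≡ Σ< f N + f N
  Σ-telescope f zero = refl
  Σ-telescope f (suc N) =
    trans (swap (Σ< (f ∘ suc) N) (f (suc N)) (f 0)) (cong (_+ f (suc N)) (Σ-telescope f N))
    where
    swap : ∀ a b c → (a + b) + c ≡ (a + c) + b
    swap = solve-∀

  Σ-mono : ∀ {f g} N → (∀ n → n < N → f n ≤ g n) → Σ< f N ≤ Σ< g N
  Σ-mono zero _ = z≤n
  Σ-mono (suc N) f≤g = +-mono-≤ (Σ-mono N (λ n n<N → f≤g n (m<n⇒m<1+n n<N))) (f≤g N ≤-refl)

  Σ-extend : ∀ f {M N} → M ≤ N → Σ< f M ≤ Σ< f N
  Σ-extend f {N = zero} z≤n = ≤-refl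
  Σ-extend f {N = suc N} M≤1+N with m≤n⇒m<n∨m≡n M≤1+N
  ... | inj₁ M<1+N = ≤-trans (Σ-extend f (s≤s⁻¹ M<1+N)) (m≤m+n (Σ< f N) (f N))
  ... | inj₂ refl = ≤-refl

  Σ-threshold : ∀ k N → Σ< (λ n → indicator (k ≤? n)) N ≤ N ∸ k
  Σ-threshold k zero = z≤n
  Σ-threshold k (suc N) with k ≤? N
  ... | yes k≤N = begin
          Σ< (λ n → indicator (k ≤? n)) N + 1 ≡⟨ +-comm _ 1 ⟩
          suc (Σ< (λ n → indicator (k ≤? n)) N) ≤⟨ s≤s (Σ-threshold k N) ⟩
          suc (N ∸ k)                           ≡⟨ sym (+-∸-assoc 1 k≤N) ⟩
          suc N ∸ k                             ∎
    where open ≤-Reasoning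
  ... | no _ = begin
          Σ< (λ n → indicator (k ≤? n)) N + 0 ≡⟨ +-identityʳ _ ⟩
          Σ< (λ n → indicator (k ≤? n)) N     ≤⟨ Σ-threshold k N ⟩
          N ∸ k                               ≤⟨ ∸-monoˡ-≤ k (n≤1+n N) ⟩
          suc N ∸ k                           ∎
    where open ≤-Reasoning

  squeeze : ∀ {a b c d} → a ≤ c → b ≤ d → c + d ≤ a + b → c ≤ a × d ≤ b
  squeeze {a} {b} {c} {d} a≤c b≤d c+d≤a+b =
    +-cancelʳ-≤ d c a (≤-trans c+d≤a+b (+-monoʳ-≤ a b≤d)) ,
    +-cancelˡ-≤ c d b (≤-trans c+d≤a+b (+-monoˡ-≤ b a≤c))

  Σ-tight : ∀ {f g} N → (∀ n → n < N → f n ≤ g n) → Σ< g N ≤ Σ< f N →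
            ∀ n → n < N → f n ≡ g n
  Σ-tight (suc N) f≤g Σg≤Σf n n<1+N
    with squeeze (Σ-mono N (λ m m<N → f≤g m (m<n⇒m<1+n m<N))) (f≤g N ≤-refl) Σg≤Σf
  ... | ΣgN≤ΣfN , gN≤fN with m≤n⇒m<n∨m≡n (s≤s⁻¹ n<1+N)
  ...   | inj₁ n<N = Σ-tight N (λ m m<N → f≤g m (m<n⇒m<1+n m<N)) ΣgN≤ΣfN n n<N
  ...   | inj₂ refl = ≤-antisym (f≤g n ≤-refl) gN≤fN

module Factors {A : Set} (_≟_ : DecidableEquality A) where

  open Words _≟_
  open import Data.List.Membership.DecPropositional _≟w_ using (_∈?_)

  ∈tails⇒Suffix : ∀ {s} w → s ∈ tails w → Suffix s w
  ∈tails⇒Suffix [] (here refl) = [] , refl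
  ∈tails⇒Suffix (x ∷ w) (here refl) = [] , refl
  ∈tails⇒Suffix (x ∷ w) (there s∈) with ∈tails⇒Suffix w s∈
  ... | p , refl = x ∷ p , refl

  Suffix⇒∈tails : ∀ {s} w → Suffix s w → s ∈ tails w
  Suffix⇒∈tails [] ([] , refl) = here refl
  Suffix⇒∈tails [] (_ ∷ _ , ())
  Suffix⇒∈tails (x ∷ w) ([] , refl) = here refl
  Suffix⇒∈tails (x ∷ w) (_ ∷ p , refl) = there (Suffix⇒∈tails w (p , refl))

  take-prefix : ∀ (v s : Word) → take (length v) (v ++ s) ≡ v
  take-prefix [] s = refl
  take-prefix (x ∷ v) s = cong (x ∷_) (take-prefix v s)

  drop-prefix : ∀ (v s : Word) → drop (length v) (v ++ s) ≡ s
  drop-prefix [] s = refl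
  drop-prefix (x ∷ v) s = drop-prefix v s

  length-snoc : ∀ (v : Word) c → length (v ++ [ c ]) ≡ suc (length v)
  length-snoc v c = trans (length-++ v) (+-comm (length v) 1)

  window⇒Factor : ∀ {v n w} → v ∈ windows n w → length v ≡ n × Factor v w
  window⇒Factor {v} {n} {w} v∈ with ∈-filter⁻ (λ u → length u ≟ℕ n) {xs = map (take n) (tails w)} v∈
  ... | v∈′ , |v|≡n with ∈-map⁻ (take n) v∈′
  ...   | t , t∈ , refl with ∈tails⇒Suffix w t∈
  ...     | p , p++t≡w = |v|≡n , p , drop n t , trans (cong (p ++_) (take++drop≡id n t)) p++t≡w

  Factor⇒window : ∀ {v n w} → length v ≡ n → Factor v w → v ∈ windows n w
  Factor⇒window {v} refl (p , s , refl) =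
    ∈-filter⁺ (λ u → length u ≟ℕ length v)
      (subst (_∈ map (take (length v)) (tails (p ++ v ++ s))) (take-prefix v s)
        (∈-map⁺ (take (length v)) (Suffix⇒∈tails (p ++ v ++ s) (p , refl))))
      refl

  factor-length≤ : ∀ {v w} → Factor v w → length v ≤ length w
  factor-length≤ {v} (p , s , refl) = ≤-trans (length-++-≤ˡ v) (length-++-≤ʳ (v ++ s) {p})

  followed⇒extends : ∀ {u w c} p s → p ++ u ++ c ∷ s ≡ w →
                     u ∈ map (take (length u)) (windows (suc (length u)) w)
  followed⇒extends {u} {w} {c} p s occurrence =
    subst (_∈ map (take (length u)) (windows (suc (length u)) w)) (take-prefix u [ c ])
      (∈-map⁺ (take (length u))
        (Factor⇒window (length-snoc u c) (p , s , trans (cong (p ++_) (++-assoc u [ c ] s)) occurrence)))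

  -- The suffix of w of length n (the whole of w if n > |w|).
  suffixOf : ℕ → Word → Word
  suffixOf n w = drop (length w ∸ n) w

  suffixOf-length : ∀ {n} w → n ≤ length w → length (suffixOf n w) ≡ n
  suffixOf-length {n} w n≤ = trans (length-drop (length w ∸ n) w) (m∸[m∸n]≡n n≤)

  suffixOf-Suffix : ∀ n w → Suffix (suffixOf n w) w
  suffixOf-Suffix n w = take (length w ∸ n) w , take++drop≡id (length w ∸ n) w

  suffixOf-++ : ∀ (p v : Word) → suffixOf (length v) (p ++ v) ≡ v
  suffixOf-++ p v = begin
    drop (length (p ++ v) ∸ length v) (p ++ v)     ≡⟨ cong (λ m → drop (m ∸ length v) (p ++ v)) (length-++ p) ⟩
    drop (length p + length v ∸ length v) (p ++ v) ≡⟨ cong (λ m → drop m (p ++ v)) (m+n∸n≡m (length p) (length v)) ⟩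
    drop (length p) (p ++ v)                       ≡⟨ drop-prefix p v ⟩
    v                                              ∎
    where open ≡-Reasoning

  window-extends : ∀ {v n w} → v ∈ windows n w →
                   v ≡ suffixOf n w ⊎ v ∈ map (take n) (windows (suc n) w)
  window-extends {v} {n} {w} v∈ with window⇒Factor {v} {n} {w} v∈
  ... | refl , p , [] , refl = inj₁ (sym (trans (cong (λ t → suffixOf (length v) (p ++ t)) (++-identityʳ v))
                                                (suffixOf-++ p v)))
  ... | refl , p , c ∷ s , refl = inj₂ (followed⇒extends p s refl)

  -- Filtering by Q after a weaker filter P is filtering by Q alone; this removes
  -- the length filter built into `windows` when counting copies of a word.
  filter-absorb : ∀ {B : Set} {P Q : B → Set} (P? : Decidable P) (Q? : Decidable Q) →
                  (∀ {v} → Q v → P v) → ∀ vs → filter Q? (filter P? vs) ≡ filter Q? vs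
  filter-absorb P? Q? Q⇒P [] = refl
  filter-absorb {P = P} {Q} P? Q? Q⇒P (v ∷ vs) = by-cases (Q? v) (P? v)
    where
    rest : filter Q? (filter P? vs) ≡ filter Q? vs
    rest = filter-absorb P? Q? Q⇒P vs
    by-cases : Dec (Q v) → Dec (P v) → filter Q? (filter P? (v ∷ vs)) ≡ filter Q? (v ∷ vs)
    by-cases (yes q) _ = begin
      filter Q? (filter P? (v ∷ vs)) ≡⟨ cong (filter Q?) (filter-accept P? (Q⇒P q)) ⟩
      filter Q? (v ∷ filter P? vs)   ≡⟨ filter-accept Q? q ⟩
      v ∷ filter Q? (filter P? vs)   ≡⟨ cong (v ∷_) rest ⟩
      v ∷ filter Q? vs               ≡⟨ sym (filter-accept Q? q) ⟩
      filter Q? (v ∷ vs)             ∎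
      where open ≡-Reasoning
    by-cases (no ¬q) (yes p) = begin
      filter Q? (filter P? (v ∷ vs)) ≡⟨ cong (filter Q?) (filter-accept P? p) ⟩
      filter Q? (v ∷ filter P? vs)   ≡⟨ filter-reject Q? ¬q ⟩
      filter Q? (filter P? vs)       ≡⟨ rest ⟩
      filter Q? vs                   ≡⟨ sym (filter-reject Q? ¬q) ⟩
      filter Q? (v ∷ vs)             ∎
      where open ≡-Reasoning
    by-cases (no ¬q) (no ¬p) = begin
      filter Q? (filter P? (v ∷ vs)) ≡⟨ cong (filter Q?) (filter-reject P? ¬p) ⟩
      filter Q? (filter P? vs)       ≡⟨ rest ⟩
      filter Q? vs                   ≡⟨ sym (filter-reject Q? ¬q) ⟩
      filter Q? (v ∷ vs)             ∎
      where open ≡-Reasoning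

  copies-of-final : ∀ u w → Suffix u w → (∀ p c s → p ++ u ++ c ∷ s ≢ w) →
                    length (filter (_≟w u) (map (take (length u)) (tails w))) ≡ 1
  copies-of-final u [] ([] , refl) _ = refl
  copies-of-final u [] (_ ∷ _ , ())
  copies-of-final u (x ∷ w) u-suffix final with take (length u) (x ∷ w) ≟w u
  ... | yes prefix = cong suc (cong length (filter-none (_≟w u) (All.tabulate later-shorter)))
    where
    -- u is a prefix of x ∷ w that is not followed by a letter, so it is all of it
    whole : length (x ∷ w) ≤ length u
    whole with drop (length u) (x ∷ w) in rest
    ... | [] = m∸n≡0⇒m≤n (trans (sym (length-drop (length u) (x ∷ w))) (cong length rest))
    ... | c ∷ s = ⊥-elim (final [] c s (begin
          u ++ c ∷ s                                          ≡⟨ cong (_++ c ∷ s) (sym prefix) ⟩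
          take (length u) (x ∷ w) ++ c ∷ s                    ≡⟨ cong (take (length u) (x ∷ w) ++_) (sym rest) ⟩
          take (length u) (x ∷ w) ++ drop (length u) (x ∷ w)  ≡⟨ take++drop≡id (length u) (x ∷ w) ⟩
          x ∷ w                                               ∎))
      where open ≡-Reasoning
    later-shorter : ∀ {v} → v ∈ map (take (length u)) (tails w) → ¬ (v ≡ u)
    later-shorter v∈ v≡u with ∈-map⁻ (take (length u)) v∈
    ... | t , t∈ , refl with ∈tails⇒Suffix w t∈
    ...   | p , p++t≡w = <⇒≱ whole (begin
            length u                    ≡⟨ cong length (sym v≡u) ⟩
            length (take (length u) t)  ≤⟨ factor-length≤ ([] , drop (length u) t , take++drop≡id (length u) t) ⟩
            length t                    ≤⟨ factor-length≤ (p , [] , trans (cong (p ++_) (++-identityʳ t)) p++t≡w) ⟩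
            length w                    ∎)
      where open ≤-Reasoning
  ... | no not-prefix = copies-of-final u w (shorter u-suffix) (λ p c s e → final (x ∷ p) c s (cong (x ∷_) e))
    where
    shorter : Suffix u (x ∷ w) → Suffix u w
    shorter ([] , refl) = ⊥-elim (not-prefix (take-all (length u) u ≤-refl))
    shorter (_ ∷ p , refl) = p , refl

  occ-final : ∀ u w → Suffix u w → (∀ p c s → p ++ u ++ c ∷ s ≢ w) → occ u w ≡ 1
  occ-final u w u-suffix final =
    trans (cong length (filter-absorb (λ v → length v ≟ℕ length u) (_≟w u) (cong length)
                                      (map (take (length u)) (tails w))))
          (copies-of-final u w u-suffix final)

  -- Below K_w the suffix of length n is not unique, hence it extends to the right.
  short-suffix-extends : ∀ {w k n} → IsK w k → n < k → n ≤ length w →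
                         suffixOf n w ∈ map (take n) (windows (suc n) w)
  short-suffix-extends {w} {k} {n} (_ , k-minimal) n<k n≤|w|
    with suffixOf n w ∈? map (take n) (windows (suc n) w)
  ... | yes extends = extends
  ... | no ¬extends = ⊥-elim (<⇒≱ n<k (begin
        k                     ≤⟨ k-minimal (suffixOf n w) (suffixOf-Suffix n w) unique ⟩
        length (suffixOf n w) ≡⟨ suffixOf-length w n≤|w| ⟩
        n                     ∎))
    where
    open ≤-Reasoning
    final : ∀ p c s → p ++ suffixOf n w ++ c ∷ s ≢ w
    final p c s occurrence =
      ¬extends (subst (λ m → suffixOf n w ∈ map (take m) (windows (suc m) w))
                      (suffixOf-length w n≤|w|) (followed⇒extends p s occurrence))
    unique : occ (suffixOf n w) w ≡ 1
    unique = occ-final (suffixOf n w) w (suffixOf-Suffix n w) final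

  right-special⇒collision : ∀ {u w n} → length u ≡ n → RightSpecial u w →
    ∃₂ λ a b → a ∈ windows (suc n) w × b ∈ windows (suc n) w × a ≢ b × take n a ≡ take n b
  right-special⇒collision {u} refl (x , y , x≢y , ux-factor , uy-factor) =
    u ++ [ x ] , u ++ [ y ] ,
    Factor⇒window (length-snoc u x) ux-factor , Factor⇒window (length-snoc u y) uy-factor ,
    (λ ux≡uy → x≢y (∷-injectiveˡ (begin
       [ x ]                        ≡⟨ sym (drop-prefix u [ x ]) ⟩
       drop (length u) (u ++ [ x ]) ≡⟨ cong (drop (length u)) ux≡uy ⟩
       drop (length u) (u ++ [ y ]) ≡⟨ drop-prefix u [ y ] ⟩
       [ y ]                        ∎))) ,
    trans (take-prefix u [ x ]) (sym (take-prefix u [ y ]))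
    where open ≡-Reasoning

module Complexity {A : Set} (_≟_ : DecidableEquality A) where

  open Words _≟_
  open Factors _≟_
  open Counting _≟w_
  open Sums

  alphSize-positive : ∀ {w} → w ≢ [] → 1 ≤ alphSize w
  alphSize-positive {[]} w≢[] = ⊥-elim (w≢[] refl)
  alphSize-positive {_ ∷ _} _ = s≤s z≤n

  C-empty : ∀ w → C w 0 ≡ 1
  C-empty w = ≤-antisym (card-cover [ [] ] [] (λ v → v) only-empty)
                        (card-≥ {zs = [ [] ]} ([] ∷ []) λ { (here refl) → Factor⇒window refl ([] , w , refl) })
    where
    only-empty : windows 0 w ⊆ [ [] ] ++ map (λ v → v) []
    only-empty {v} v∈ with window⇒Factor {v} {0} {w} v∈
    only-empty {[]} _ | _ = here refl
    only-empty {_ ∷ _} _ | () , _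

  C-beyond : ∀ w → C w (suc (length w)) ≡ 0
  C-beyond w = n≤0⇒n≡0 (card-cover [] [] (λ v → v) none)
    where
    none : windows (suc (length w)) w ⊆ [] ++ map (λ v → v) []
    none {v} v∈ with window⇒Factor {v} {suc (length w)} {w} v∈
    ... | |v|≡1+|w| , v-factor =
      ⊥-elim (<-irrefl refl (subst (_≤ length w) |v|≡1+|w| (factor-length≤ v-factor)))

  alph≤C1 : ∀ w → alphSize w ≤ C w 1
  alph≤C1 w = subst (_≤ C w 1) (length-map [_] (deduplicate _≟_ w))
                    (card-≥ (Unique.map⁺ ∷-injectiveˡ (deduplicate-! _≟_ w)) letters-are-factors)
    where
    letters-are-factors : map [_] (deduplicate _≟_ w) ⊆ windows 1 w
    letters-are-factors v∈ with ∈-map⁻ [_] v∈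
    ... | x , x∈ , refl with ∈-∃++ (∈-deduplicate⁻ _≟_ w x∈)
    ...   | p , s , w≡ = Factor⇒window refl (p , s , sym w≡)

  windows-cover : ∀ {w k n} → IsK w k → n ≤ length w →
                  windows n w ⊆ when (k ≤? n) [ suffixOf n w ] ++ map (take n) (windows (suc n) w)
  windows-cover {w} {k} {n} isK n≤|w| {v} v∈ with window-extends {v} {n} {w} v∈ | k ≤? n
  ... | inj₂ extends | d = ∈-++⁺ʳ (when d [ suffixOf n w ]) extends
  ... | inj₁ refl | yes _ = here refl
  ... | inj₁ refl | no k≰n = short-suffix-extends isK (≰⇒> k≰n) n≤|w|

  complexity-growth-0 : ∀ {w} k → w ≢ [] → C w 0 + (alphSize w ∸ 1) ≤ C w 1 + indicator (k ≤? 0)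
  complexity-growth-0 {w} k w≢[] = begin
    C w 0 + (alphSize w ∸ 1) ≡⟨ cong (_+ (alphSize w ∸ 1)) (C-empty w) ⟩
    1 + (alphSize w ∸ 1)     ≡⟨ m+[n∸m]≡n (alphSize-positive w≢[]) ⟩
    alphSize w               ≤⟨ alph≤C1 w ⟩
    C w 1                    ≤⟨ m≤m+n (C w 1) _ ⟩
    C w 1 + indicator (k ≤? 0) ∎
    where open ≤-Reasoning

  complexity-growth : ∀ {w r k n} → IsR w r → IsK w k → 1 ≤ n → n ≤ length w →
                      C w n + indicator (n <? r) ≤ C w (suc n) + indicator (k ≤? n)
  complexity-growth {w} {r} {k} {n} (_ , _ , special-below) isK 1≤n n≤|w| = by-cases (n <? r)
    where
    open ≤-Reasoning
    extra : List Word
    extra = when (k ≤? n) [ suffixOf n w ]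
    cover : windows n w ⊆ extra ++ map (take n) (windows (suc n) w)
    cover = windows-cover isK n≤|w|
    extra-count : length extra + C w (suc n) ≡ C w (suc n) + indicator (k ≤? n)
    extra-count = trans (cong (_+ C w (suc n)) (length-when (k ≤? n) (suffixOf n w)))
                        (+-comm (indicator (k ≤? n)) (C w (suc n)))
    by-cases : (d : Dec (n < r)) → C w n + indicator d ≤ C w (suc n) + indicator (k ≤? n)
    by-cases (no _) = begin
      C w n + 0                    ≡⟨ +-identityʳ (C w n) ⟩
      C w n                        ≤⟨ card-cover extra (windows (suc n) w) (take n) cover ⟩
      length extra + C w (suc n)   ≡⟨ extra-count ⟩
      C w (suc n) + indicator (k ≤? n) ∎
    by-cases (yes n<r) with special-below n 1≤n n<r
    ... | u , |u|≡n , special with right-special⇒collision |u|≡n special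
    ...   | a , b , a∈ , b∈ , a≢b , same-prefix = begin
      C w n + 1                    ≡⟨ +-comm (C w n) 1 ⟩
      suc (C w n)                  ≤⟨ card-cover-strict extra (windows (suc n) w) (take n)
                                        a b a∈ b∈ a≢b same-prefix cover ⟩
      length extra + C w (suc n)   ≡⟨ extra-count ⟩
      C w (suc n) + indicator (k ≤? n) ∎

-- Words whose complexity obeys an exact two-threshold recurrence are GT-words.

module Profile {A : Set} (_≟_ : DecidableEquality A) where

  open Words _≟_
  open Complexity _≟_ using (C-empty; alphSize-positive)
  open Sums

  Balanced : Word → ℕ → ℕ → Set
  Balanced w r k = ∀ n → 1 ≤ n → n ≤ length w →
                   C w n + indicator (n <? r) ≡ C w (suc n) + indicator (k ≤? n)

  -- The second alternative in the definition of GT, for given m and M.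
  GTProfile : Word → ℕ → ℕ → Set
  GTProfile w m M = 1 ≤ m × m ≤ M
    × C w 0 ≡ 1
    × (∀ i → 1 ≤ i → i ≤ m → C w i ≡ alphSize w + i ∸ 1)
    × (∀ i → m ≤ i → i ≤ M ∸ 1 → C w (suc i) ≡ C w i)
    × (∀ i → M ≤ i → i ≤ length w → C w (suc i) + 1 ≡ C w i)

  ≤∸1⇒< : ∀ {i M} → 1 ≤ M → i ≤ M ∸ 1 → i < M
  ≤∸1⇒< {M = suc _} _ i≤M-1 = s≤s i≤M-1

  module Phases {w : Word} {r k : ℕ} (balanced : Balanced w r k) where

    rising : ∀ n → 1 ≤ n → n ≤ length w → n < r → n < k → C w (suc n) ≡ suc (C w n)
    rising n 1≤n n≤|w| n<r n<k = begin
      C w (suc n)                      ≡⟨ sym (+-identityʳ (C w (suc n))) ⟩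
      C w (suc n) + 0                  ≡⟨ cong (C w (suc n) +_) (sym (indicator-no (k ≤? n) (<⇒≱ n<k))) ⟩
      C w (suc n) + indicator (k ≤? n) ≡⟨ sym (balanced n 1≤n n≤|w|) ⟩
      C w n + indicator (n <? r)       ≡⟨ cong (C w n +_) (indicator-yes (n <? r) n<r) ⟩
      C w n + 1                        ≡⟨ +-comm (C w n) 1 ⟩
      suc (C w n)                      ∎
      where open ≡-Reasoning

    level : ∀ n → 1 ≤ n → n ≤ length w → indicator (n <? r) ≡ indicator (k ≤? n) →
            C w (suc n) ≡ C w n
    level n 1≤n n≤|w| same = sym (+-cancelʳ-≡ (indicator (k ≤? n)) (C w n) (C w (suc n))
                                   (trans (cong (C w n +_) (sym same)) (balanced n 1≤n n≤|w|)))

    falling : ∀ n → 1 ≤ n → n ≤ length w → r ≤ n → k ≤ n → C w (suc n) + 1 ≡ C w n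
    falling n 1≤n n≤|w| r≤n k≤n = begin
      C w (suc n) + 1                  ≡⟨ cong (C w (suc n) +_) (sym (indicator-yes (k ≤? n) k≤n)) ⟩
      C w (suc n) + indicator (k ≤? n) ≡⟨ sym (balanced n 1≤n n≤|w|) ⟩
      C w n + indicator (n <? r)       ≡⟨ cong (C w n +_) (indicator-no (n <? r) (≤⇒≯ r≤n)) ⟩
      C w n + 0                        ≡⟨ +-identityʳ (C w n) ⟩
      C w n                            ∎
      where open ≡-Reasoning

    rise-phase : ∀ m → m ≤ r → m ≤ k → m ≤ length w → C w 1 ≡ alphSize w →
                 ∀ i → 1 ≤ i → i ≤ m → C w i ≡ alphSize w + i ∸ 1
    rise-phase m m≤r m≤k m≤|w| C1≡a (suc zero) _ _ = trans C1≡a (sym (m+n∸n≡m (alphSize w) 1))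
    rise-phase m m≤r m≤k m≤|w| C1≡a (suc (suc j)) _ 2+j≤m = begin
      C w (suc (suc j))      ≡⟨ rising (suc j) (s≤s z≤n) (≤-trans (<⇒≤ 2+j≤m) m≤|w|)
                                  (≤-trans 2+j≤m m≤r) (≤-trans 2+j≤m m≤k) ⟩
      suc (C w (suc j))      ≡⟨ cong suc (rise-phase m m≤r m≤k m≤|w| C1≡a (suc j) (s≤s z≤n) (<⇒≤ 2+j≤m)) ⟩
      suc (a + suc j ∸ 1)    ≡⟨ cong suc (pred-+ j) ⟩
      suc (a + j)            ≡⟨ sym (+-suc a j) ⟩
      a + suc j              ≡⟨ sym (pred-+ (suc j)) ⟩
      a + suc (suc j) ∸ 1    ∎
      where
      open ≡-Reasoning
      a : ℕ
      a = alphSize w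
      pred-+ : ∀ j → a + suc j ∸ 1 ≡ a + j
      pred-+ j = cong (_∸ 1) (+-suc a j)

    -- With m = min(r, k) and M = max(r, k) the three phases form a GT profile.
    two-thresholds : ∀ m M → 1 ≤ m → m ≤ r → m ≤ k → r ≤ M → k ≤ M → M ≤ length w →
                     C w 1 ≡ alphSize w →
                     (∀ i → m ≤ i → i < M → indicator (i <? r) ≡ indicator (k ≤? i)) →
                     GTProfile w m M
    two-thresholds m M 1≤m m≤r m≤k r≤M k≤M M≤|w| C1≡a between =
      1≤m , m≤M , C-empty w ,
      rise-phase m m≤r m≤k (≤-trans m≤M M≤|w|) C1≡a ,
      (λ i m≤i i≤M-1 → let i<M = ≤∸1⇒< 1≤M i≤M-1 in
         level i (≤-trans 1≤m m≤i) (≤-trans (<⇒≤ i<M) M≤|w|) (between i m≤i i<M)) ,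
      (λ i M≤i i≤|w| → falling i (≤-trans 1≤M M≤i) i≤|w| (≤-trans r≤M M≤i) (≤-trans k≤M M≤i))
      where
      m≤M : m ≤ M
      m≤M = ≤-trans m≤r r≤M
      1≤M : 1 ≤ M
      1≤M = ≤-trans 1≤m m≤M

  thresholds⇒GT : ∀ {w r k} → w ≢ [] → 1 ≤ r → 1 ≤ k → r ≤ length w → k ≤ length w →
                  C w 1 ≡ alphSize w → Balanced w r k → GT w
  thresholds⇒GT {w} {r} {k} w≢[] 1≤r 1≤k r≤|w| k≤|w| C1≡a balanced with 2 ≤? alphSize w | r ≤? k
  ... | no a≱2 | _ = inj₁ (w≢[] , ≤-antisym (s≤s⁻¹ (≰⇒> a≱2)) (alphSize-positive w≢[]))
  ... | yes a≥2 | yes r≤k = inj₂ (a≥2 , r , k ,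
        two-thresholds r k 1≤r ≤-refl r≤k r≤k ≤-refl k≤|w| C1≡a
          (λ i r≤i i<k → trans (indicator-no (i <? r) (≤⇒≯ r≤i)) (sym (indicator-no (k ≤? i) (<⇒≱ i<k)))))
    where open Phases balanced
  ... | yes a≥2 | no r≰k = inj₂ (a≥2 , k , r ,
        two-thresholds k r 1≤k (<⇒≤ k<r) ≤-refl ≤-refl (<⇒≤ k<r) r≤|w| C1≡a
          (λ i k≤i i<r → trans (indicator-yes (i <? r) i<r) (sym (indicator-yes (k ≤? i) k≤i))))
    where
    open Phases balanced
    k<r : k < r
    k<r = ≰⇒> r≰k

-- The equality case: under |w| = R_w + K_w + |Alph(w)| - 2 every local
-- complexity inequality is an equality.

module Extremal {A : Set} (_≟_ : DecidableEquality A) (w : List A) (r k : ℕ)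
                (w≢[] : w ≢ []) (isR : Words.IsR _≟_ w r) (isK : Words.IsK _≟_ w k)
                (|w|≡ : length w ≡ r + k + Words.alphSize _≟_ w ∸ 2) where

  open Words _≟_
  open Complexity _≟_
  open Profile _≟_ using (Balanced)
  open Sums

  -- Abbreviations; N = |w| + 1 is the number of local inequalities.
  a r′ a′ N : ℕ
  a = alphSize w
  r′ = r ∸ 1
  a′ = a ∸ 1
  N = suc (length w)

  R-positive : 1 ≤ r
  R-positive = proj₁ isR

  |w|-split : length w ≡ r′ + k + a′
  |w|-split = trans |w|≡ (split r k a R-positive (alphSize-positive w≢[]))
    where
    split : ∀ r k a → 1 ≤ r → 1 ≤ a → r + k + a ∸ 2 ≡ (r ∸ 1) + k + (a ∸ 1)
    split (suc r) k (suc a) _ _ = cong (_∸ 1) (+-suc (r + k) a)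

  gain : ℕ → ℕ
  gain zero = a′
  gain (suc n) = indicator (suc n <? r)

  loss : ℕ → ℕ
  loss n = indicator (k ≤? n)

  local : ∀ n → n < N → C w n + gain n ≤ C w (suc n) + loss n
  local zero _ = complexity-growth-0 k w≢[]
  local (suc n) (s≤s n<|w|) = complexity-growth isR isK (s≤s z≤n) n<|w|

  Σgain-prefix : ∀ j → j < r → Σ< gain (suc j) ≡ a′ + j
  Σgain-prefix zero _ = sym (+-identityʳ a′)
  Σgain-prefix (suc j) 1+j<r = begin
    Σ< gain (suc j) + indicator (suc j <? r) ≡⟨ cong₂ _+_ (Σgain-prefix j (<⇒≤ 1+j<r))
                                                        (indicator-yes (suc j <? r) 1+j<r) ⟩
    a′ + j + 1                              ≡⟨ +-assoc a′ j 1 ⟩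
    a′ + (j + 1)                            ≡⟨ cong (a′ +_) (+-comm j 1) ⟩
    a′ + suc j                              ∎
    where open ≡-Reasoning

  Σgain-≥ : a′ + r′ ≤ Σ< gain N
  Σgain-≥ = begin
    a′ + r′           ≡⟨ sym (Σgain-prefix r′ (≤-reflexive (m+[n∸m]≡n R-positive))) ⟩
    Σ< gain (suc r′)  ≤⟨ Σ-extend gain (s≤s r′≤|w|) ⟩
    Σ< gain N         ∎
    where
    open ≤-Reasoning
    r′≤|w| : r′ ≤ length w
    r′≤|w| = ≤-trans (≤-trans (m≤m+n r′ k) (m≤m+n (r′ + k) a′)) (≤-reflexive (sym |w|-split))

  Σloss-≤ : Σ< loss N ≤ suc (r′ + a′)
  Σloss-≤ = begin
    Σ< loss N                  ≤⟨ Σ-threshold k N ⟩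
    N ∸ k                      ≡⟨ cong (λ t → suc t ∸ k) |w|-split ⟩
    suc (r′ + k + a′) ∸ k      ≡⟨ cong (_∸ k) (move-k r′ k a′) ⟩
    suc (r′ + a′) + k ∸ k      ≡⟨ m+n∸n≡m (suc (r′ + a′)) k ⟩
    suc (r′ + a′)              ∎
    where
    open ≤-Reasoning
    move-k : ∀ x y z → suc (x + y + z) ≡ suc (x + z) + y
    move-k = solve-∀

  ΣC-shift : Σ< (C w ∘ suc) N + 1 ≡ Σ< (C w) N
  ΣC-shift = begin
    Σ< (C w ∘ suc) N + 1     ≡⟨ cong (Σ< (C w ∘ suc) N +_) (sym (C-empty w)) ⟩
    Σ< (C w ∘ suc) N + C w 0 ≡⟨ Σ-telescope (C w) N ⟩
    Σ< (C w) N + C w N       ≡⟨ cong (Σ< (C w) N +_) (C-beyond w) ⟩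
    Σ< (C w) N + 0           ≡⟨ +-identityʳ (Σ< (C w) N) ⟩
    Σ< (C w) N               ∎
    where open ≡-Reasoning

  global : Σ< (λ n → C w (suc n) + loss n) N ≤ Σ< (λ n → C w n + gain n) N
  global = begin
    Σ< (λ n → C w (suc n) + loss n) N    ≡⟨ Σ-+ (C w ∘ suc) loss N ⟩
    X + Σ< loss N                        ≤⟨ +-monoʳ-≤ X Σloss-≤ ⟩
    X + suc (r′ + a′)                    ≡⟨ regroup X r′ a′ ⟩
    (X + 1) + (a′ + r′)                  ≤⟨ +-monoʳ-≤ (X + 1) Σgain-≥ ⟩
    (X + 1) + Σ< gain N                  ≡⟨ cong (_+ Σ< gain N) ΣC-shift ⟩
    Σ< (C w) N + Σ< gain N               ≡⟨ sym (Σ-+ (C w) gain N) ⟩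
    Σ< (λ n → C w n + gain n) N          ∎
    where
    open ≤-Reasoning
    X : ℕ
    X = Σ< (C w ∘ suc) N
    regroup : ∀ x y z → x + suc (y + z) ≡ (x + 1) + (z + y)
    regroup = solve-∀

  balanced-everywhere : ∀ n → n ≤ length w → C w n + gain n ≡ C w (suc n) + loss n
  balanced-everywhere n n≤|w| = Σ-tight N local global n (s≤s n≤|w|)

  C0+a′ : C w 0 + a′ ≡ a
  C0+a′ = trans (cong (_+ a′) (C-empty w)) (m+[n∸m]≡n (alphSize-positive w≢[]))

  -- K_w = 0 would force C(1) = |Alph(w)| - 1 at n = 0.
  K-positive : 1 ≤ k
  K-positive = ≰⇒> k≰0
    where
    k≰0 : ¬ k ≤ 0
    k≰0 k≤0 = <⇒≱ (≤-reflexive (begin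
      suc (C w 1)    ≡⟨ +-comm 1 (C w 1) ⟩
      C w 1 + 1      ≡⟨ cong (C w 1 +_) (sym (indicator-yes (k ≤? 0) k≤0)) ⟩
      C w 1 + loss 0 ≡⟨ sym (balanced-everywhere 0 z≤n) ⟩
      C w 0 + a′     ≡⟨ C0+a′ ⟩
      a              ∎)) (alph≤C1 w)
      where open ≡-Reasoning

  -- With K_w ≥ 1 the equation at n = 0 reads C(1) = |Alph(w)|.
  C-one : C w 1 ≡ a
  C-one = begin
    C w 1          ≡⟨ sym (+-identityʳ (C w 1)) ⟩
    C w 1 + 0      ≡⟨ cong (C w 1 +_) (sym (indicator-no (k ≤? 0) (<⇒≱ K-positive))) ⟩
    C w 1 + loss 0 ≡⟨ sym (balanced-everywhere 0 z≤n) ⟩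
    C w 0 + a′     ≡⟨ C0+a′ ⟩
    a              ∎
    where open ≡-Reasoning

  R≤|w| : r ≤ length w
  R≤|w| = begin
    r            ≡⟨ sym (m+[n∸m]≡n R-positive) ⟩
    1 + r′       ≤⟨ +-monoˡ-≤ r′ K-positive ⟩
    k + r′       ≡⟨ +-comm k r′ ⟩
    r′ + k       ≤⟨ m≤m+n (r′ + k) a′ ⟩
    r′ + k + a′  ≡⟨ sym |w|-split ⟩
    length w     ∎
    where open ≤-Reasoning

  K≤|w| : k ≤ length w
  K≤|w| = ≤-trans (≤-trans (m≤n+m k r′) (m≤m+n (r′ + k) a′)) (≤-reflexive (sym |w|-split))

  balanced : Balanced w r k
  balanced (suc n) _ 1+n≤|w| = balanced-everywhere (suc n) 1+n≤|w|

corollary2p3 : {A : Set} (_≟_ : DecidableEquality A) (w : List A) (r k : ℕ)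
    → w ≢ []
    → Words.IsR _≟_ w r
    → Words.IsK _≟_ w k
    → length w ≡ r + k + Words.alphSize _≟_ w ∸ 2
    → Words.GT _≟_ w
corollary2p3 _≟_ w r k w≢[] isR isK |w|≡ =
  thresholds⇒GT w≢[] R-positive K-positive R≤|w| K≤|w| C-one balanced
  where
  open Extremal _≟_ w r k w≢[] isR isK |w|≡
  open Profile _≟_ using (thresholds⇒GT)
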